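{- Let $q\geq 3$ and $n\geq 1$ be integers, and let $G=H(n,q)$ be the Hamming graph. Then \[ \left\lfloor\left(1-\tfrac1q\right)n\right\rfloor +1\leq b(G)\leq\left\lfloor\left(1-\tfrac1q\right)n+\tfrac{q+1}2\right\rfloor, \] where $b(G)$ denotes the burning number of $G$.
   Context: For positive integers $n,q$, let $[q]=\{1,\ldots,q\}$. The Hamming graph $H(n,q)$ has vertex set $[q]^n$, and two vertices are adjacent iff they differ in exactly one coordinate; the graph distance $d(u,v)$ is the Hamming distance (number of coordinates in which $u,v$ differ). For a finite graph $G$ with vertex set $V$, a vertex $v$ and an integer $k\geq 0$, let $\Gamma_k(v)=\{u\in V: d(u,v)\leq k\}$. A sequence $(v_1,\ldots,v_b)$ of vertices is a burning sequence of length $b$ if $\Gamma_{b-1}(v_1)\cup\Gamma_{b-2}(v_2)\cup\cdots\cup\Gamma_0(v_b)=V$. The burning number $b(G)$ is the minimum length of a burning sequence of $G$. -}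

module Defs where

open import Data.Nat using (ℕ; zero; suc; _+_; _*_; _∸_; _≤_)
open import Data.Nat.DivMod using (_/_)
open import Data.Fin using (Fin; toℕ)
open import Data.Fin.Properties using (_≟_)
open import Data.Vec using (Vec; []; _∷_; lookup)
open import Data.Product using (Σ; ∃; _×_)
open import Relation.Nullary using (yes; no)

Vertex : ℕ → ℕ → Set
Vertex n q = Vec (Fin q) n

-- Hamming distance = graph distance in H(n,q)
hamming : ∀ {n q} → Vertex n q → Vertex n q → ℕ
hamming [] [] = 0
hamming (x ∷ xs) (y ∷ ys) with x ≟ y
... | yes _ = hamming xs ys
... | no _  = suc (hamming xs ys)

InBall : ∀ {n q} → ℕ → Vertex n q → Vertex n q → Set
InBall k v u = hamming u v ≤ k

-- (v_1,…,v_b) is a burning sequence: Γ_{b-1}(v_1) ∪ … ∪ Γ_0(v_b) = V.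
-- Index i : Fin b corresponds to v_{i+1}, whose radius is b - (i+1).
IsBurningSeq : ∀ {n q} (b : ℕ) → Vec (Vertex n q) b → Set
IsBurningSeq {n} {q} b s =
  (u : Vertex n q) → ∃ λ (i : Fin b) → InBall (b ∸ suc (toℕ i)) (lookup s i) u

HasBurningSeq : ℕ → ℕ → ℕ → Set
HasBurningSeq n q b = Σ (Vec (Vertex n q) b) (IsBurningSeq b)

IsBurningNumber : ℕ → ℕ → ℕ → Set
IsBurningNumber n q b = HasBurningSeq n q b × (∀ b′ → HasBurningSeq n q b′ → b ≤ b′)

-- floor division; the divisor is always nonzero where it is used
_div_ : ℕ → ℕ → ℕ
m div zero = 0
m div suc k = m / suc k

-- ⌊(1 - 1/q) n⌋ = ⌊(q-1)n / q⌋
lowerBound : ℕ → ℕ → ℕ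
lowerBound n q = ((q ∸ 1) * n) div q

-- ⌊(1 - 1/q) n + (q+1)/2⌋ = ⌊(2(q-1)n + q(q+1)) / (2q)⌋
upperBound : ℕ → ℕ → ℕ
upperBound n q = (2 * ((q ∸ 1) * n) + q * (q + 1)) div (2 * q)

{-# OPTIONS --safe #-}
module Submission where

-- Upper bound: burn the constant words 0ⁿ, 1ⁿ, …, (q−1)ⁿ, 0ⁿ, … for U = ⌊(1 − 1/q)n + (q+1)/2⌋ rounds.
-- Summing d(u, cⁿ) + c over all colours c gives (q−1)n + q(q−1)/2 < qU, so some colour c has
-- d(u, cⁿ) ≤ U − 1 − c, i.e. u lies in the ball of the c-th centre (if n < U, the first ball
-- already covers everything).
--
-- Lower bound: if b ≤ (1 − 1/q)n, the uniform fractional word (1/q, …, 1/q) agrees with every vertex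
-- in n/q ≤ n − b coordinates.  Iterated rounding turns it into a genuine word u whose agreement with
-- the i-th centre exceeds that fractional agreement by less than i + 1, so u escapes every ball
-- Γ_{b−1−i}(v_i).  While more than k + 1 coordinates are still fractional, a nonzero kernel vector of
-- the k + 1 agreement constraints gives a direction that keeps them fixed, and moving along it until a
-- weight hits 0 shrinks the support; once at most k + 1 coordinates are fractional, the agreement
-- with v_k moves by less than k + 1 whatever happens to them.

open import Defs

open import Algebra.Bundles using (CommutativeRing; Semiring)
import Algebra.Properties.Semiring.Sum as SemiringSum
open import Data.Bool.Base using (if_then_else_)
open import Data.Empty using (⊥-elim)
open import Data.Fin.Base as Fin using (Fin; zero; suc; toℕ; fromℕ<)
import Data.Fin.Properties as Finₚ
import Data.Nat.Base as Nat
open Nat using (ℕ; zero; suc)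
import Data.Nat.Properties as ℕₚ
open import Data.Product using (Σ; ∃; ∃₂; _×_; _,_; proj₁; proj₂; uncurry)
open import Data.Vec.Base using (Vec; []; _∷_; lookup; tabulate; replicate)
import Data.Vec.Properties as Vecₚ
open import Function.Base using (_∘_)
open import Level using (0ℓ)
open import Relation.Binary.PropositionalEquality
  using (_≡_; _≢_; refl; sym; trans; cong; cong₂; subst; subst₂; module ≡-Reasoning)
open import Relation.Nullary using (¬_; Dec; yes; no; does; ¬?)
open import Relation.Nullary.Decidable using (map′; dec-true; dec-false; decidable-stable)
open import Relation.Unary using (Pred; Decidable)
open import Data.Nat.Induction using (<-rec)
import Data.Nat.DivMod as DivMod

module ℕSum = SemiringSum ℕₚ.+-*-semiring
open ℕSum using () renaming (sum to ∑ℕ)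

module NatSums where

  open Nat using (_+_; _*_; _≤_; _<_; z≤n; s≤s)
  open import Data.Nat.Tactic.RingSolver using (solve-∀)

  ∑ℕ-const : ∀ {m} k → ∑ℕ {m} (λ _ → k) ≡ m * k
  ∑ℕ-const {zero}  k = refl
  ∑ℕ-const {suc m} k = cong (k +_) (∑ℕ-const {m} k)

  ∑ℕ-suc : ∀ {m} (f : Fin m → ℕ) → ∑ℕ (λ j → suc (f j)) ≡ m + ∑ℕ f
  ∑ℕ-suc {zero}  f = refl
  ∑ℕ-suc {suc m} f = begin
    suc (f zero) + ∑ℕ (λ j → suc (f (suc j)))   ≡⟨ cong (suc (f zero) +_) (∑ℕ-suc (f ∘ suc)) ⟩
    suc (f zero) + (m + ∑ℕ (f ∘ suc))           ≡⟨ swap (f zero) m (∑ℕ (f ∘ suc)) ⟩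
    suc m + (f zero + ∑ℕ (f ∘ suc))             ∎
    where
    open ≡-Reasoning
    swap : ∀ a m s → suc a + (m + s) ≡ suc m + (a + s)
    swap = solve-∀

  double-∑-toℕ : ∀ m → 2 * ∑ℕ {suc m} toℕ ≡ suc m * m
  double-∑-toℕ zero    = refl
  double-∑-toℕ (suc m) = begin
    2 * ∑ℕ {suc m} (λ j → suc (toℕ j))   ≡⟨ cong (2 *_) (∑ℕ-suc {suc m} toℕ) ⟩
    2 * (suc m + ∑ℕ {suc m} toℕ)         ≡⟨ ℕₚ.*-distribˡ-+ 2 (suc m) (∑ℕ {suc m} toℕ) ⟩
    2 * suc m + 2 * ∑ℕ {suc m} toℕ       ≡⟨ cong (2 * suc m +_) (double-∑-toℕ m) ⟩
    2 * suc m + suc m * m                ≡⟨ collect m ⟩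
    suc (suc m) * suc m                  ∎
    where
    open ≡-Reasoning
    collect : ∀ m → 2 * suc m + suc m * m ≡ suc (suc m) * suc m
    collect = solve-∀

  ∑ℕ-mono-≤ : ∀ {n} {f g : Fin n → ℕ} → (∀ j → f j ≤ g j) → ∑ℕ f ≤ ∑ℕ g
  ∑ℕ-mono-≤ {zero}  f≤g = z≤n
  ∑ℕ-mono-≤ {suc n} f≤g = ℕₚ.+-mono-≤ (f≤g zero) (∑ℕ-mono-≤ (f≤g ∘ suc))

  ∑ℕ-mono-< : ∀ {n} {f g : Fin n → ℕ} → (∀ j → f j ≤ g j) → ∀ j → f j < g j → ∑ℕ f < ∑ℕ g
  ∑ℕ-mono-< f≤g zero    fj<gj = ℕₚ.+-mono-<-≤ fj<gj (∑ℕ-mono-≤ (f≤g ∘ suc))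
  ∑ℕ-mono-< f≤g (suc j) fj<gj = ℕₚ.+-mono-≤-< (f≤g zero) (∑ℕ-mono-< (f≤g ∘ suc) j fj<gj)

  indicator : ∀ {a} {A : Set a} → Dec A → ℕ
  indicator d = if does d then 1 else 0

  indicator-yes : ∀ {A : Set} (d : Dec A) → A → indicator d ≡ 1
  indicator-yes d a = cong (if_then 1 else 0) (dec-true d a)

  indicator-no : ∀ {A : Set} (d : Dec A) → ¬ A → indicator d ≡ 0
  indicator-no d ¬a = cong (if_then 1 else 0) (dec-false d ¬a)

  count : ∀ {n} {P : Pred (Fin n) 0ℓ} → Decidable P → ℕ
  count P? = ∑ℕ (indicator ∘ P?)

  count-none : ∀ {n} {P : Pred (Fin n) 0ℓ} (P? : Decidable P) → (∀ j → ¬ P j) → count P? ≡ 0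
  count-none {zero}  P? none = refl
  count-none {suc n} P? none with P? zero
  ... | yes P₀ = ⊥-elim (none zero P₀)
  ... | no  _  = count-none (P? ∘ suc) (none ∘ suc)

  count-≟ : ∀ {n} (a : Fin n) → count (a Finₚ.≟_) ≡ 1
  count-≟ {suc n} zero    = cong suc (count-none {n} (λ c → zero Finₚ.≟ suc c) λ _ ())
  count-≟ {suc n} (suc a) = count-≟ a

  module _ {n} {P Q : Pred (Fin n) 0ℓ} (P? : Decidable P) (Q? : Decidable Q) (P⊆Q : ∀ j → P j → Q j) where

    private
      indicator-mono : ∀ j → indicator (P? j) ≤ indicator (Q? j)
      indicator-mono j with P? j | Q? j
      ... | yes Pj | no ¬Qj = ⊥-elim (¬Qj (P⊆Q j Pj))
      ... | yes _  | yes _  = ℕₚ.≤-refl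
      ... | no _   | _      = z≤n

    count-mono-≤ : count P? ≤ count Q?
    count-mono-≤ = ∑ℕ-mono-≤ indicator-mono

    count-mono-< : ∀ j → ¬ P j → Q j → count P? < count Q?
    count-mono-< j ¬Pj Qj = ∑ℕ-mono-< indicator-mono j (indicator-< (P? j) (Q? j))
      where
      indicator-< : (p : Dec (P j)) (q : Dec (Q j)) → indicator p < indicator q
      indicator-< (yes Pj) _        = ⊥-elim (¬Pj Pj)
      indicator-< (no _)   (yes _)  = s≤s z≤n
      indicator-< (no _)   (no ¬Qj) = ⊥-elim (¬Qj Qj)

open NatSums

module Rationals where

  import Data.Rational.Base as ℚ
  open ℚ public using (ℚ; 0ℚ; 1ℚ; _+_; _*_; _-_; -_; _≤_; _<_; 1/_; NonZero; >-nonZero; positive; nonNegative; nonPositive)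
  import Data.Rational.Properties as ℚₚ
  open ℚₚ using (≤-refl; <-≤-trans; <⇒≤)
  import Algebra.Properties.Semiring.Mult as SemiringMult

  ℚ-semiring : Semiring 0ℓ 0ℓ
  ℚ-semiring = CommutativeRing.semiring ℚₚ.+-*-commutativeRing

  open SemiringSum ℚ-semiring public
    using (sum-cong-≗; ∑-distrib-+; *-distribˡ-sum; sum-replicate-zero) renaming (sum to ∑)
  open SemiringSum ℚ-semiring using (sum-remove; sum-replicate)
  open SemiringMult ℚ-semiring using (×-homo-+; ×1-homo-*; ×-assoc-*) renaming (_×_ to _×ℚ_)

  -- The embedding ℕ → ℚ as m ↦ m × 1, so that its homomorphism laws come from Algebra.Properties.Semiring.Mult.
  fromℕ : ℕ → ℚ
  fromℕ m = m ×ℚ 1ℚ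

  0≤1 : 0ℚ ≤ 1ℚ
  0≤1 = ℚₚ.nonNegative⁻¹ 1ℚ

  0<1 : 0ℚ < 1ℚ
  0<1 = ℚₚ.positive⁻¹ 1ℚ

  *-≢0 : ∀ {p q} → p ≢ 0ℚ → q ≢ 0ℚ → p * q ≢ 0ℚ
  *-≢0 {p} {q} p≢0 q≢0 pq≡0 = q≢0 (begin
    q                ≡⟨ ℚₚ.*-identityˡ q ⟨
    1ℚ * q           ≡⟨ cong (_* q) (ℚₚ.*-inverseˡ p) ⟨
    (1/ p * p) * q   ≡⟨ ℚₚ.*-assoc (1/ p) p q ⟩
    1/ p * (p * q)   ≡⟨ cong (1/ p *_) pq≡0 ⟩
    1/ p * 0ℚ        ≡⟨ ℚₚ.*-zeroʳ (1/ p) ⟩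
    0ℚ               ∎)
    where
    open ≡-Reasoning
    instance _ = ℚ.≢-nonZero p≢0

  fromℕ-+ : ∀ m n → fromℕ (m Nat.+ n) ≡ fromℕ m + fromℕ n
  fromℕ-+ = ×-homo-+ 1ℚ

  fromℕ-* : ∀ m n → fromℕ (m Nat.* n) ≡ fromℕ m * fromℕ n
  fromℕ-* = ×1-homo-*

  fromℕ-nonNeg : ∀ m → 0ℚ ≤ fromℕ m
  fromℕ-nonNeg zero    = ≤-refl
  fromℕ-nonNeg (suc m) = ℚₚ.+-mono-≤ 0≤1 (fromℕ-nonNeg m)

  fromℕ-suc-pos : ∀ m → 0ℚ < fromℕ (suc m)
  fromℕ-suc-pos m = ℚₚ.+-mono-<-≤ 0<1 (fromℕ-nonNeg m)

  0≤p⇒0-p≤0 : ∀ {p} → 0ℚ ≤ p → 0ℚ - p ≤ 0ℚ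
  0≤p⇒0-p≤0 {p} 0≤p = subst (_≤ 0ℚ) (sym (ℚₚ.+-identityˡ (- p))) (ℚₚ.neg-antimono-≤ 0≤p)

  nonNeg*nonNeg : ∀ {p q} → 0ℚ ≤ p → 0ℚ ≤ q → 0ℚ ≤ p * q
  nonNeg*nonNeg {p} {q} 0≤p 0≤q = ℚₚ.nonNegative⁻¹ (p * q)
    {{ℚₚ.nonNeg*nonNeg⇒nonNeg p {{nonNegative 0≤p}} q {{nonNegative 0≤q}}}}

  fromℕ-mono-≤ : ∀ {m n} → m Nat.≤ n → fromℕ m ≤ fromℕ n
  fromℕ-mono-≤ {m} m≤n with ℕₚ.m≤n⇒∃[o]m+o≡n m≤n
  ... | o , refl = subst (_≤ fromℕ (m Nat.+ o)) (ℚₚ.+-identityʳ (fromℕ m))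
                     (subst (fromℕ m + 0ℚ ≤_) (sym (fromℕ-+ m o)) (ℚₚ.+-monoʳ-≤ (fromℕ m) (fromℕ-nonNeg o)))

  fromℕ-cancel-< : ∀ {m n} → fromℕ m < fromℕ n → m Nat.< n
  fromℕ-cancel-< {m} {n} fm<fn = ℕₚ.≰⇒> λ n≤m → ℚₚ.<-irrefl refl (<-≤-trans fm<fn (fromℕ-mono-≤ n≤m))

  fromℕ-∑ : ∀ {n} (f : Fin n → ℕ) → fromℕ (∑ℕ f) ≡ ∑ (fromℕ ∘ f)
  fromℕ-∑ {zero}  f = refl
  fromℕ-∑ {suc n} f = trans (fromℕ-+ (f zero) _) (cong (fromℕ (f zero) +_) (fromℕ-∑ (f ∘ suc)))

  ∑-const : ∀ {n} c → ∑ {n} (λ _ → c) ≡ fromℕ n * c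
  ∑-const {n} c = begin
    ∑ {n} (λ _ → c)   ≡⟨ sum-replicate n ⟩
    n ×ℚ c            ≡⟨ cong (n ×ℚ_) (ℚₚ.*-identityˡ c) ⟨
    n ×ℚ (1ℚ * c)     ≡⟨ ×-assoc-* n 1ℚ c ⟨
    fromℕ n * c       ∎
    where open ≡-Reasoning

  ∑-mono-≤ : ∀ {n} {f g : Fin n → ℚ} → (∀ j → f j ≤ g j) → ∑ f ≤ ∑ g
  ∑-mono-≤ {zero}  f≤g = ≤-refl
  ∑-mono-≤ {suc n} f≤g = ℚₚ.+-mono-≤ (f≤g zero) (∑-mono-≤ (f≤g ∘ suc))

  ∑-mono-< : ∀ {n} {f g : Fin n → ℚ} → (∀ j → f j ≤ g j) → ∀ j → f j < g j → ∑ f < ∑ g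
  ∑-mono-< f≤g zero    fj<gj = ℚₚ.+-mono-<-≤ fj<gj (∑-mono-≤ (f≤g ∘ suc))
  ∑-mono-< f≤g (suc j) fj<gj = ℚₚ.+-mono-≤-< (f≤g zero) (∑-mono-< (f≤g ∘ suc) j fj<gj)

  ∑-single : ∀ {n} (f : Fin n → ℚ) i → (∀ j → j ≢ i → f j ≡ 0ℚ) → ∑ f ≡ f i
  ∑-single {suc n} f i rest = begin
    ∑ f                            ≡⟨ sum-remove f ⟩
    f i + ∑ (f ∘ Fin.punchIn i)    ≡⟨ cong (f i +_) (sum-cong-≗ (λ j → rest _ (Finₚ.punchInᵢ≢i i j))) ⟩
    f i + ∑ {n} (λ _ → 0ℚ)         ≡⟨ cong (f i +_) (sum-replicate-zero n) ⟩
    f i + 0ℚ                       ≡⟨ ℚₚ.+-identityʳ (f i) ⟩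
    f i                            ∎
    where open ≡-Reasoning

  ∑-neg : ∀ {n} (f : Fin n → ℚ) → ∑ (λ j → - f j) ≡ - ∑ f
  ∑-neg {zero}  f = refl
  ∑-neg {suc n} f = trans (cong (- f zero +_) (∑-neg (f ∘ suc))) (sym (ℚₚ.neg-distrib-+ (f zero) (∑ (f ∘ suc))))

  fromℕ-1 : fromℕ 1 ≡ 1ℚ
  fromℕ-1 = ℚₚ.+-identityʳ 1ℚ

  positive-entry : ∀ {n} (f : Fin n → ℚ) → ∑ f ≡ 1ℚ → ∃ λ j → 0ℚ < f j
  positive-entry {n} f ∑f≡1 with Finₚ.any? (λ j → 0ℚ ℚₚ.<? f j)
  ... | yes found = found
  ... | no  none  = ⊥-elim (ℚₚ.<-irrefl refl (begin-strict
    0ℚ                 <⟨ 0<1 ⟩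
    1ℚ                 ≡⟨ ∑f≡1 ⟨
    ∑ f                ≤⟨ ∑-mono-≤ (λ j → ℚₚ.≮⇒≥ λ 0<fj → none (j , 0<fj)) ⟩
    ∑ {n} (λ _ → 0ℚ)   ≡⟨ sum-replicate-zero n ⟩
    0ℚ                 ∎))
    where open ℚₚ.≤-Reasoning

  module _ {n} {P : Pred (Fin n) 0ℓ} (P? : Decidable P) {f : Fin n → ℚ}
           (f<1 : ∀ j → f j < 1ℚ) (f≤0 : ∀ j → ¬ P j → f j ≤ 0ℚ) where

    private
      f≤indicator : ∀ j → f j ≤ fromℕ (indicator (P? j))
      f≤indicator j with P? j
      ... | yes _  = <⇒≤ (subst (f j <_) (sym fromℕ-1) (f<1 j))
      ... | no ¬Pj = f≤0 j ¬Pj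

      f<indicator : ∀ j → P j → f j < fromℕ (indicator (P? j))
      f<indicator j Pj with P? j
      ... | yes _  = subst (f j <_) (sym fromℕ-1) (f<1 j)
      ... | no ¬Pj = ⊥-elim (¬Pj Pj)

    ∑<suc-count : ∀ {k} → count P? Nat.≤ suc k → ∑ f < fromℕ (suc k)
    ∑<suc-count {k} few with Finₚ.any? P?
    ... | yes (j , Pj) = begin-strict
      ∑ f                                   <⟨ ∑-mono-< f≤indicator j (f<indicator j Pj) ⟩
      ∑ (λ j → fromℕ (indicator (P? j)))    ≡⟨ fromℕ-∑ (indicator ∘ P?) ⟨
      fromℕ (count P?)                      ≤⟨ fromℕ-mono-≤ few ⟩
      fromℕ (suc k)                         ∎
      where open ℚₚ.≤-Reasoning
    ... | no none = begin-strict
      ∑ f                 ≤⟨ ∑-mono-≤ (λ j → f≤0 j λ Pj → none (j , Pj)) ⟩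
      ∑ {n} (λ _ → 0ℚ)    ≡⟨ sum-replicate-zero n ⟩
      0ℚ                  <⟨ fromℕ-suc-pos k ⟩
      fromℕ (suc k)       ∎
      where open ℚₚ.≤-Reasoning

module HomogeneousSystems where

  open Rationals
  open Nat using (s≤s)
  import Data.Rational.Properties as ℚₚ
  open import Data.Rational.Solver using (module +-*-Solver)
  open +-*-Solver using (solve; _:+_; _:*_; _:-_; :-_; _:=_)
  open import Data.List.Base using (List; _++_; [_]; length; map)
  import Data.List.Properties as Listₚ
  open import Data.List.Relation.Unary.All as All using (All)
  import Data.List.Relation.Unary.All.Properties as Allₚ
  open import Data.List.Membership.Propositional using (find)
  open import Data.List.Membership.Propositional.Properties using (∈-∃++)
  import Data.Vec.Functional as Vector

  _·_ : ∀ {N} → (Fin N → ℚ) → (Fin N → ℚ) → ℚ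
  r · t = ∑ λ j → r j * t j

  NontrivialSolution : ∀ {N} → Pred (Fin N) 0ℓ → List (Fin N → ℚ) → Set
  NontrivialSolution {N} Free rows =
    Σ (Fin N → ℚ) λ t → (∃ λ j → t j ≢ 0ℚ) × (∀ j → ¬ Free j → t j ≡ 0ℚ) × All (λ r → r · t ≡ 0ℚ) rows

  module _ {N} {Free : Pred (Fin (suc N)) 0ℓ} where

    solution-without-first : ¬ Free zero → ∀ {rows} →
      NontrivialSolution (Free ∘ suc) (map Vector.tail rows) → NontrivialSolution Free rows
    solution-without-first ¬free₀ (s , (j , sj≢0) , s-free , s⊥) =
      0ℚ Vector.∷ s , (suc j , sj≢0) , t-free , All.map (λ {r} → ⊥-tail r) (Allₚ.map⁻ s⊥)
      where
      t-free : ∀ j → ¬ Free j → (0ℚ Vector.∷ s) j ≡ 0ℚ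
      t-free zero    _ = refl
      t-free (suc j) ¬free = s-free j ¬free
      open ≡-Reasoning
      ⊥-tail : ∀ r → Vector.tail r · s ≡ 0ℚ → r · (0ℚ Vector.∷ s) ≡ 0ℚ
      ⊥-tail r tail⊥ = begin
        r zero * 0ℚ + Vector.tail r · s   ≡⟨ cong₂ _+_ (ℚₚ.*-zeroʳ (r zero)) tail⊥ ⟩
        0ℚ + 0ℚ                           ≡⟨ ℚₚ.+-identityˡ 0ℚ ⟩
        0ℚ                                ∎

    first-unit-solution : Free zero → ∀ {rows} → All (λ r → r zero ≡ 0ℚ) rows → NontrivialSolution Free rows
    first-unit-solution free₀ first-column-zero =
      e₀ , (zero , ℚₚ.1≢0) , e₀-free , All.map (λ {r} → ⊥-e₀ r) first-column-zero
      where
      e₀ : Fin (suc N) → ℚ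
      e₀ = 1ℚ Vector.∷ λ _ → 0ℚ
      e₀-free : ∀ j → ¬ Free j → e₀ j ≡ 0ℚ
      e₀-free zero    ¬free₀ = ⊥-elim (¬free₀ free₀)
      e₀-free (suc j) _      = refl
      open ≡-Reasoning
      ⊥-e₀ : ∀ r → r zero ≡ 0ℚ → r · e₀ ≡ 0ℚ
      ⊥-e₀ r r₀≡0 = begin
        r zero * 1ℚ + ∑ (λ j → r (suc j) * 0ℚ)
          ≡⟨ cong₂ _+_ (cong (_* 1ℚ) r₀≡0) (sum-cong-≗ (ℚₚ.*-zeroʳ ∘ Vector.tail r)) ⟩
        0ℚ * 1ℚ + ∑ {N} (λ _ → 0ℚ)
          ≡⟨ cong (0ℚ * 1ℚ +_) (sum-replicate-zero N) ⟩
        0ℚ ∎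

  module Pivot {N} (pivot : Fin (suc N) → ℚ) where

    eliminate : (Fin (suc N) → ℚ) → Fin N → ℚ
    eliminate r j = pivot zero * r (suc j) - r zero * pivot (suc j)

    extend : (Fin N → ℚ) → Fin (suc N) → ℚ
    extend s = - (Vector.tail pivot · s) Vector.∷ λ j → pivot zero * s j

    extend-· : ∀ r s → r · extend s ≡ eliminate r · s
    extend-· r s = begin
      r zero * - D + ∑ (λ j → r (suc j) * (p₀ * s j))
        ≡⟨ cong (r zero * - D +_) (trans (sum-cong-≗ λ j → swap (r (suc j)) p₀ (s j)) (sym (*-distribˡ-sum p₀ (λ j → r (suc j) * s j)))) ⟩
      r zero * - D + p₀ * E
        ≡⟨ solve 4 (λ a d p e → a :* (:- d) :+ p :* e := p :* e :+ (:- a) :* d) refl (r zero) D p₀ E ⟩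
      p₀ * E + - r zero * D
        ≡⟨ cong₂ _+_ (*-distribˡ-sum p₀ (λ j → r (suc j) * s j)) (*-distribˡ-sum (- r zero) (λ j → pivot (suc j) * s j)) ⟩
      ∑ (λ j → p₀ * (r (suc j) * s j)) + ∑ (λ j → - r zero * (pivot (suc j) * s j))
        ≡⟨ ∑-distrib-+ (λ j → p₀ * (r (suc j) * s j)) (λ j → - r zero * (pivot (suc j) * s j)) ⟨
      ∑ (λ j → p₀ * (r (suc j) * s j) + - r zero * (pivot (suc j) * s j))
        ≡⟨ sum-cong-≗ (λ j → solve 5 (λ p a z b u → p :* (a :* u) :+ (:- z) :* (b :* u) := (p :* a :- z :* b) :* u)
                                      refl p₀ (r (suc j)) (r zero) (pivot (suc j)) (s j)) ⟩
      eliminate r · s ∎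
      where
      p₀ D E : ℚ
      p₀ = pivot zero
      D = Vector.tail pivot · s
      E = Vector.tail r · s
      swap : ∀ a p u → a * (p * u) ≡ p * (a * u)
      swap = solve 3 (λ a p u → a :* (p :* u) := p :* (a :* u)) refl
      open ≡-Reasoning

    eliminate-pivot : ∀ s → eliminate pivot · s ≡ 0ℚ
    eliminate-pivot s = begin
      ∑ (λ j → eliminate pivot j * s j)   ≡⟨ sum-cong-≗ (λ j → trans (cong (_* s j) (cancels j)) (ℚₚ.*-zeroˡ (s j))) ⟩
      ∑ {N} (λ _ → 0ℚ)                    ≡⟨ sum-replicate-zero N ⟩
      0ℚ                                  ∎
      where
      open ≡-Reasoning
      cancels : ∀ j → eliminate pivot j ≡ 0ℚ
      cancels j = ℚₚ.+-inverseʳ (pivot zero * pivot (suc j))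

    pivot-solution : ∀ {Free : Pred (Fin (suc N)) 0ℓ} → pivot zero ≢ 0ℚ → Free zero → ∀ pre post →
      NontrivialSolution (Free ∘ suc) (map eliminate (pre ++ post)) →
      NontrivialSolution Free (pre ++ [ pivot ] ++ post)
    pivot-solution {Free} p₀≢0 free₀ pre post (s , (j , sj≢0) , s-free , s⊥) =
      extend s , (suc j , *-≢0 p₀≢0 sj≢0) , t-free , Allₚ.++⁺ (Allₚ.++⁻ˡ pre ⊥others) (⊥pivot All.∷ Allₚ.++⁻ʳ pre ⊥others)
      where
      t-free : ∀ j → ¬ Free j → extend s j ≡ 0ℚ
      t-free zero    ¬free₀ = ⊥-elim (¬free₀ free₀)
      t-free (suc j) ¬free  = trans (cong (pivot zero *_) (s-free j ¬free)) (ℚₚ.*-zeroʳ (pivot zero))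
      ⊥others : All (λ r → r · extend s ≡ 0ℚ) (pre ++ post)
      ⊥others = All.map (λ {r} → trans (extend-· r s)) (Allₚ.map⁻ s⊥)
      ⊥pivot : pivot · extend s ≡ 0ℚ
      ⊥pivot = trans (extend-· pivot s) (eliminate-pivot s)

  nontrivial-solution : ∀ {N} {Free : Pred (Fin N) 0ℓ} (free? : Decidable Free) (rows : List (Fin N → ℚ)) →
    length rows Nat.< count free? → NontrivialSolution Free rows
  nontrivial-solution {zero}          free? rows ()
  nontrivial-solution {suc N} {Free} free? rows = by-first-unknown (free? zero)
    where
    free-rest? : Decidable (Free ∘ suc)
    free-rest? = free? ∘ suc
    by-first-unknown : (d : Dec (Free zero)) → length rows Nat.< indicator d Nat.+ count free-rest? →
      NontrivialSolution Free rows
    by-first-unknown (no ¬free₀) len =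
      solution-without-first ¬free₀ (nontrivial-solution free-rest? (map Vector.tail rows)
        (subst (Nat._< count free-rest?) (sym (Listₚ.length-map Vector.tail rows)) len))
    by-first-unknown (yes free₀) (s≤s len) with All.all? (λ r → r zero ℚₚ.≟ 0ℚ) rows
    ... | yes column₀≡0 = first-unit-solution free₀ column₀≡0
    ... | no  column₀≢0 =
      let pivot , pivot∈rows , pivot₀≢0 = find (Allₚ.¬All⇒Any¬ (λ r → r zero ℚₚ.≟ 0ℚ) rows column₀≢0)
          pre , post , rows≡ = ∈-∃++ pivot∈rows
          open Pivot pivot
          shorter : length (map eliminate (pre ++ post)) Nat.< count free-rest?
          shorter = begin-strict
            length (map eliminate (pre ++ post))   ≡⟨ Listₚ.length-map eliminate (pre ++ post) ⟩
            length (pre ++ post)                   <⟨ ℕₚ.n<1+n _ ⟩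
            suc (length (pre ++ post))             ≡⟨ Listₚ.length-++-sucʳ pre pivot post ⟨
            length (pre ++ [ pivot ] ++ post)      ≡⟨ cong length rows≡ ⟨
            length rows                            ≤⟨ len ⟩
            count free-rest?                       ∎
      in subst (NontrivialSolution Free) (sym rows≡)
           (pivot-solution pivot₀≢0 free₀ pre post (nontrivial-solution free-rest? _ shorter))
      where open ℕₚ.≤-Reasoning

module Boundary where

  open Rationals
  import Data.Rational.Properties as ℚₚ
  open import Data.Rational.Solver using (module +-*-Solver)
  open +-*-Solver using (solve; _:+_; _:*_; _:-_; :-_; _:=_; con)
  open import Data.List.Base using (List; filter)
  open import Relation.Binary.Bundles using (DecTotalOrder)
  open import Data.List.Extrema (DecTotalOrder.totalOrder ℚₚ.≤-decTotalOrder) using (argmin; argmin-all; f[argmin]≤f[xs])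
  open import Data.List.Membership.Propositional using (_∈_)
  open import Data.List.Membership.Propositional.Properties using (∈-filter⁺)
  import Data.List.Relation.Unary.All as All
  import Data.List.Relation.Unary.All.Properties as Allₚ

  module _ {I : Set} (x w : I → ℚ) where

    -- Defaults to 0 where w i ≥ 0; it is only ever compared at indices with w i < 0.
    exit-time : I → ℚ
    exit-time i with w i ℚₚ.<? 0ℚ
    ... | yes wᵢ<0 = x i * (1/ (- w i)) {{>-nonZero (ℚₚ.neg-antimono-< wᵢ<0)}}
    ... | no  _    = 0ℚ

    exit-time-reaches-0 : ∀ i → w i < 0ℚ → x i + exit-time i * w i ≡ 0ℚ
    exit-time-reaches-0 i wᵢ<0 with w i ℚₚ.<? 0ℚ
    ... | no wᵢ≮0 = ⊥-elim (wᵢ≮0 wᵢ<0)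
    ... | yes wᵢ<0 = begin
      x i + (x i * 1/ - w i) * w i     ≡⟨ solve 3 (λ a r u → a :+ (a :* r) :* u := a :- a :* ((:- u) :* r)) refl (x i) (1/ - w i) (w i) ⟩
      x i - x i * (- w i * 1/ - w i)   ≡⟨ cong (λ e → x i - x i * e) (ℚₚ.*-inverseʳ (- w i)) ⟩
      x i - x i * 1ℚ                   ≡⟨ solve 1 (λ a → a :- a :* con 1ℚ := con 0ℚ) refl (x i) ⟩
      0ℚ                               ∎
      where
      open ≡-Reasoning
      instance _ = >-nonZero (ℚₚ.neg-antimono-< wᵢ<0)

    exit-time-nonNeg : (∀ i → 0ℚ ≤ x i) → ∀ i → 0ℚ ≤ exit-time i
    exit-time-nonNeg x≥0 i with w i ℚₚ.<? 0ℚ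
    ... | yes wᵢ<0 = nonNeg*nonNeg (x≥0 i) (ℚₚ.<⇒≤ (ℚₚ.positive⁻¹ _ {{ℚₚ.1/pos⇒pos (- w i)}}))
      where instance _ = positive (ℚₚ.neg-antimono-< wᵢ<0)
    ... | no  _    = ℚₚ.≤-refl

    step-to-boundary : (is : List I) → (∀ i → i ∈ is) → (∀ i → 0ℚ ≤ x i) → ∀ {i₀} → w i₀ < 0ℚ →
      Σ ℚ λ s → (∀ i → 0ℚ ≤ x i + s * w i) × ∃ λ i → w i < 0ℚ × x i + s * w i ≡ 0ℚ
    step-to-boundary is enumerates x≥0 {i₀} wᵢ₀<0 = s , stays-nonNeg , i* , wᵢ*<0 , exit-time-reaches-0 i* wᵢ*<0
      where
      leaving : List I
      leaving = filter (λ i → w i ℚₚ.<? 0ℚ) is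
      i* : I
      i* = argmin exit-time i₀ leaving
      s : ℚ
      s = exit-time i*
      wᵢ*<0 : w i* < 0ℚ
      wᵢ*<0 = argmin-all exit-time wᵢ₀<0 (Allₚ.all-filter (λ i → w i ℚₚ.<? 0ℚ) is)
      s-minimal : ∀ i → w i < 0ℚ → s ≤ exit-time i
      s-minimal i wᵢ<0 = All.lookup (f[argmin]≤f[xs] i₀ leaving) (∈-filter⁺ (λ i → w i ℚₚ.<? 0ℚ) (enumerates i) wᵢ<0)
      stays-nonNeg : ∀ i → 0ℚ ≤ x i + s * w i
      stays-nonNeg i = by-sign (w i ℚₚ.<? 0ℚ)
        where
        by-sign : Dec (w i < 0ℚ) → 0ℚ ≤ x i + s * w i
        by-sign (yes wᵢ<0) = subst (_≤ x i + s * w i) (exit-time-reaches-0 i wᵢ<0)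
          (ℚₚ.+-monoʳ-≤ (x i) (ℚₚ.*-monoʳ-≤-nonPos (w i) {{nonPositive (ℚₚ.<⇒≤ wᵢ<0)}} (s-minimal i wᵢ<0)))
        by-sign (no wᵢ≮0) = subst (_≤ x i + s * w i) (ℚₚ.+-identityˡ 0ℚ)
          (ℚₚ.+-mono-≤ (x≥0 i) (nonNeg*nonNeg (exit-time-nonNeg x≥0 i*) (ℚₚ.≮⇒≥ wᵢ≮0)))

module FractionalWords {n q : ℕ} where

  open Rationals
  import Data.Rational.Properties as ℚₚ
  open import Data.Rational.Solver using (module +-*-Solver)
  open +-*-Solver using (solve; _:+_; _:*_; _:-_; :-_; _:=_; con)
  open HomogeneousSystems using (_·_; nontrivial-solution)
  open Boundary using (step-to-boundary)
  open import Data.List.Base using (List; length; map; cartesianProduct; allFin; applyUpTo)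
  open import Data.Nat.Induction using (Acc; acc; <-wellFounded)
  open import Data.Sum using (inj₁; inj₂)
  import Data.List.Properties as Listₚ
  open import Data.List.Membership.Propositional using (_∈_)
  open import Data.List.Membership.Propositional.Properties using (∈-allFin; ∈-cartesianProduct⁺)
  open import Data.List.Relation.Unary.All as All using (All)
  import Data.List.Relation.Unary.All.Properties as Allₚ
  open import Relation.Nullary.Decidable using (_×-dec_)
  open import Relation.Binary.Definitions using (tri<; tri≈; tri>)

  Word : Set
  Word = Fin n → Fin q

  Weights : Set
  Weights = Fin n → Fin q → ℚ

  record IsStochastic (x : Weights) : Set where
    field
      nonNeg : ∀ j c → 0ℚ ≤ x j c
      rowSum : ∀ j → ∑ (x j) ≡ 1ℚ

  agreement : Weights → Word → ℚ
  agreement x v = ∑ λ j → x j (v j)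

  matches : Word → Word → ℕ
  matches u v = count λ j → u j Finₚ.≟ v j

  InSupport : Weights → Fin n → Pred (Fin q) 0ℓ
  InSupport x j c = 0ℚ < x j c

  Supports : Weights → Word → Set
  Supports x u = ∀ j → InSupport x j (u j)

  _⊑_ : Weights → Weights → Set
  x′ ⊑ x = ∀ j c → InSupport x′ j c → InSupport x j c

  Split : Weights → Pred (Fin n) 0ℓ
  Split x j = ∃₂ λ a b → a ≢ b × InSupport x j a × InSupport x j b

  inSupport? : ∀ x j → Decidable (InSupport x j)
  inSupport? x j c = 0ℚ ℚₚ.<? x j c

  split? : ∀ x → Decidable (Split x)
  split? x j = Finₚ.any? λ a → Finₚ.any? λ b → ¬? (a Finₚ.≟ b) ×-dec inSupport? x j a ×-dec inSupport? x j b

  supportSize : Weights → ℕ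
  supportSize x = ∑ℕ λ j → count (inSupport? x j)

  module _ {x} (st : IsStochastic x) {u} (supp : Supports x u) where

    open IsStochastic st

    unsplit⇒point-mass : ∀ j → ¬ Split x j → x j (u j) ≡ 1ℚ
    unsplit⇒point-mass j unsplit = trans (sym (∑-single (x j) (u j) elsewhere-0)) (rowSum j)
      where
      elsewhere-0 : ∀ c → c ≢ u j → x j c ≡ 0ℚ
      elsewhere-0 c c≢uⱼ = ℚₚ.≤-antisym (ℚₚ.≮⇒≥ λ 0<xⱼc → unsplit (c , u j , c≢uⱼ , 0<xⱼc , supp j)) (nonNeg j c)

    rounding-error : Word → Fin n → ℚ
    rounding-error v j = fromℕ (indicator (u j Finₚ.≟ v j)) - x j (v j)

    rounding-error<1 : ∀ v j → rounding-error v j < 1ℚ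
    rounding-error<1 v j with u j Finₚ.≟ v j
    ... | yes uⱼ≡vⱼ = begin-strict
      fromℕ 1 - x j (v j)   <⟨ ℚₚ.+-monoʳ-< (fromℕ 1) (ℚₚ.neg-antimono-< (subst (InSupport x j) uⱼ≡vⱼ (supp j))) ⟩
      fromℕ 1 - 0ℚ          ≡⟨ ℚₚ.+-identityʳ (fromℕ 1) ⟩
      fromℕ 1               ≡⟨ fromℕ-1 ⟩
      1ℚ                    ∎
      where open ℚₚ.≤-Reasoning
    ... | no  _     = ℚₚ.≤-<-trans (0≤p⇒0-p≤0 (nonNeg j (v j))) 0<1

    unsplit⇒rounding-error≤0 : ∀ v j → ¬ Split x j → rounding-error v j ≤ 0ℚ
    unsplit⇒rounding-error≤0 v j unsplit with u j Finₚ.≟ v j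
    ... | yes uⱼ≡vⱼ = ℚₚ.≤-reflexive (begin
      fromℕ 1 - x j (v j)   ≡⟨ cong (λ c → fromℕ 1 - x j c) uⱼ≡vⱼ ⟨
      fromℕ 1 - x j (u j)   ≡⟨ cong (fromℕ 1 +_) (cong -_ (unsplit⇒point-mass j unsplit)) ⟩
      1ℚ - 1ℚ               ≡⟨ ℚₚ.+-inverseʳ 1ℚ ⟩
      0ℚ                    ∎)
      where open ≡-Reasoning
    ... | no  _     = 0≤p⇒0-p≤0 (nonNeg j (v j))

    rounding-bound : ∀ {k} v → count (split? x) Nat.≤ suc k → fromℕ (matches u v) < agreement x v + fromℕ (suc k)
    rounding-bound {k} v few = begin-strict
      fromℕ (matches u v)
        ≡⟨ fromℕ-∑ (λ j → indicator (u j Finₚ.≟ v j)) ⟩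
      ∑ (λ j → fromℕ (indicator (u j Finₚ.≟ v j)))
        ≡⟨ sum-cong-≗ (λ j → split-off (fromℕ (indicator (u j Finₚ.≟ v j))) (x j (v j))) ⟩
      ∑ (λ j → x j (v j) + rounding-error v j)
        ≡⟨ ∑-distrib-+ (λ j → x j (v j)) (rounding-error v) ⟩
      agreement x v + ∑ (rounding-error v)
        <⟨ ℚₚ.+-monoʳ-< (agreement x v) (∑<suc-count (split? x) (rounding-error<1 v) (unsplit⇒rounding-error≤0 v) few) ⟩
      agreement x v + fromℕ (suc k) ∎
      where
      open ℚₚ.≤-Reasoning
      split-off : ∀ a b → a ≡ b + (a - b)
      split-off = solve 2 (λ a b → a := b :+ (a :- b)) refl

  ∑-indicator-≟ : ∀ (a : Fin q) → ∑ (λ c → fromℕ (indicator (a Finₚ.≟ c))) ≡ 1ℚ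
  ∑-indicator-≟ a = trans (sym (fromℕ-∑ (λ c → indicator (a Finₚ.≟ c)))) (trans (cong fromℕ (count-≟ a)) fromℕ-1)

  module _ (x : Weights) (j : Fin n) where

    direction-for : Dec (Split x j) → Fin q → ℚ
    direction-for (yes (a , b , _)) c = fromℕ (indicator (a Finₚ.≟ c)) - fromℕ (indicator (b Finₚ.≟ c))
    direction-for (no _)            c = 0ℚ

    ∑-direction-for : ∀ d → ∑ (direction-for d) ≡ 0ℚ
    ∑-direction-for (yes (a , b , _)) = begin
      ∑ (λ c → fromℕ (indicator (a Finₚ.≟ c)) - fromℕ (indicator (b Finₚ.≟ c)))
        ≡⟨ ∑-distrib-+ (λ c → fromℕ (indicator (a Finₚ.≟ c))) (λ c → - fromℕ (indicator (b Finₚ.≟ c))) ⟩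
      ∑ (λ c → fromℕ (indicator (a Finₚ.≟ c))) + ∑ (λ c → - fromℕ (indicator (b Finₚ.≟ c)))
        ≡⟨ cong₂ _+_ (∑-indicator-≟ a) (trans (∑-neg (λ c → fromℕ (indicator (b Finₚ.≟ c)))) (cong -_ (∑-indicator-≟ b))) ⟩
      1ℚ - 1ℚ
        ≡⟨ ℚₚ.+-inverseʳ 1ℚ ⟩
      0ℚ ∎
      where open ≡-Reasoning
    ∑-direction-for (no _) = sum-replicate-zero q

    direction-for-support : ∀ d c → direction-for d c ≢ 0ℚ → 0ℚ < x j c
    direction-for-support (no _) c 0≢0 = ⊥-elim (0≢0 refl)
    direction-for-support (yes (a , b , _ , 0<xⱼa , 0<xⱼb)) c dᶜ≢0 with a Finₚ.≟ c | b Finₚ.≟ c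
    ... | yes a≡c | _       = subst (λ c → 0ℚ < x j c) a≡c 0<xⱼa
    ... | no _    | yes b≡c = subst (λ c → 0ℚ < x j c) b≡c 0<xⱼb
    ... | no _    | no _    = ⊥-elim (dᶜ≢0 refl)

    direction-for-negative : ∀ d → Split x j → ∀ t → t ≢ 0ℚ → ∃ λ c → t * direction-for d c < 0ℚ
    direction-for-negative (no unsplit) split = ⊥-elim (unsplit split)
    direction-for-negative (yes (a , b , a≢b , _)) _ t t≢0 with ℚₚ.<-cmp t 0ℚ
    ... | tri< t<0 _ _ = a , subst (_< 0ℚ) (sym (trans (cong (t *_) at-a) (ℚₚ.*-identityʳ t))) t<0
      where
      at-a : fromℕ (indicator (a Finₚ.≟ a)) - fromℕ (indicator (b Finₚ.≟ a)) ≡ 1ℚ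
      at-a = cong₂ (λ k l → fromℕ k - fromℕ l) (indicator-yes (a Finₚ.≟ a) refl) (indicator-no (b Finₚ.≟ a) (a≢b ∘ sym))
    ... | tri≈ _ t≡0 _ = ⊥-elim (t≢0 t≡0)
    ... | tri> _ _ 0<t = b , subst (_< 0ℚ) (sym (trans (cong (t *_) at-b) (solve 1 (λ t → t :* con (- 1ℚ) := :- t) refl t)))
                                   (ℚₚ.neg-antimono-< 0<t)
      where
      at-b : fromℕ (indicator (a Finₚ.≟ b)) - fromℕ (indicator (b Finₚ.≟ b)) ≡ - 1ℚ
      at-b = cong₂ (λ k l → fromℕ k - fromℕ l) (indicator-no (a Finₚ.≟ b) a≢b) (indicator-yes (b Finₚ.≟ b) refl)

  direction : Weights → Weights
  direction x j = direction-for x j (split? x j)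

  constraint : Weights → Word → Fin n → ℚ
  constraint x v j = direction x j (v j)

  perturb : Weights → ℚ → (Fin n → ℚ) → Weights
  perturb x s t j c = x j c + s * (t j * direction x j c)

  module _ (x : Weights) (s : ℚ) (t : Fin n → ℚ) where

    perturb-rowSum : ∀ j → ∑ (perturb x s t j) ≡ ∑ (x j)
    perturb-rowSum j = begin
      ∑ (λ c → x j c + s * (t j * direction x j c))
        ≡⟨ ∑-distrib-+ (x j) (λ c → s * (t j * direction x j c)) ⟩
      ∑ (x j) + ∑ (λ c → s * (t j * direction x j c))
        ≡⟨ cong (∑ (x j) +_) (sum-cong-≗ λ c → ℚₚ.*-assoc s (t j) (direction x j c)) ⟨
      ∑ (x j) + ∑ (λ c → s * t j * direction x j c)
        ≡⟨ cong (∑ (x j) +_) (*-distribˡ-sum (s * t j) (direction x j)) ⟨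
      ∑ (x j) + s * t j * ∑ (direction x j)
        ≡⟨ cong (λ e → ∑ (x j) + s * t j * e) (∑-direction-for x j (split? x j)) ⟩
      ∑ (x j) + s * t j * 0ℚ
        ≡⟨ solve 2 (λ a b → a :+ b :* con 0ℚ := a) refl (∑ (x j)) (s * t j) ⟩
      ∑ (x j) ∎
      where open ≡-Reasoning

    perturb-agreement : ∀ v → constraint x v · t ≡ 0ℚ → agreement (perturb x s t) v ≡ agreement x v
    perturb-agreement v v⊥t = begin
      ∑ (λ j → x j (v j) + s * (t j * constraint x v j))
        ≡⟨ ∑-distrib-+ (λ j → x j (v j)) (λ j → s * (t j * constraint x v j)) ⟩
      agreement x v + ∑ (λ j → s * (t j * constraint x v j))
        ≡⟨ cong (agreement x v +_) (sum-cong-≗ λ j → cong (s *_) (ℚₚ.*-comm (t j) (constraint x v j))) ⟩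
      agreement x v + ∑ (λ j → s * (constraint x v j * t j))
        ≡⟨ cong (agreement x v +_) (*-distribˡ-sum s (λ j → constraint x v j * t j)) ⟨
      agreement x v + s * (constraint x v · t)
        ≡⟨ cong (λ e → agreement x v + s * e) v⊥t ⟩
      agreement x v + s * 0ℚ
        ≡⟨ cong (agreement x v +_) (ℚₚ.*-zeroʳ s) ⟩
      agreement x v + 0ℚ
        ≡⟨ ℚₚ.+-identityʳ (agreement x v) ⟩
      agreement x v ∎
      where open ≡-Reasoning

    moving⇒in-support : ∀ j c → t j * direction x j c ≢ 0ℚ → InSupport x j c
    moving⇒in-support j c moving = direction-for-support x j (split? x j) c λ dᶜ≡0 →
      moving (trans (cong (t j *_) dᶜ≡0) (ℚₚ.*-zeroʳ (t j)))

    perturb-⊑ : perturb x s t ⊑ x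
    perturb-⊑ j c 0<x′ with t j * direction x j c ℚₚ.≟ 0ℚ
    ... | no  moving = moving⇒in-support j c moving
    ... | yes still  = subst (0ℚ <_) unchanged 0<x′
      where
      unchanged : perturb x s t j c ≡ x j c
      unchanged = trans (cong (λ e → x j c + s * e) still) (solve 2 (λ a s → a :+ s :* con 0ℚ := a) refl (x j c) s)

    perturb-shrinks : ∀ j c → InSupport x j c → perturb x s t j c ≡ 0ℚ → supportSize (perturb x s t) Nat.< supportSize x
    perturb-shrinks j c 0<xⱼc killed =
      ∑ℕ-mono-< (λ j → count-mono-≤ (inSupport? (perturb x s t) j) (inSupport? x j) (perturb-⊑ j)) j
        (count-mono-< (inSupport? (perturb x s t) j) (inSupport? x j) (perturb-⊑ j) c (ℚₚ.<-irrefl (sym killed)) 0<xⱼc)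

  step-to-smaller-support : ∀ {x} → IsStochastic x → ∀ t {j₀} → Split x j₀ → t j₀ ≢ 0ℚ →
    ∃ λ s → IsStochastic (perturb x s t) × supportSize (perturb x s t) Nat.< supportSize x
  step-to-smaller-support {x} st t {j₀} j₀-split tⱼ₀≢0 =
    let c₀ , w₀<0 = direction-for-negative x j₀ (split? x j₀) j₀-split (t j₀) tⱼ₀≢0
        s , nonNeg′ , (j* , c*) , w*<0 , killed = step-to-boundary (uncurry x) w pairs enumerates (uncurry nonNeg) w₀<0
    in s , record { nonNeg = λ j c → nonNeg′ (j , c) ; rowSum = λ j → trans (perturb-rowSum x s t j) (rowSum j) }
         , perturb-shrinks x s t j* c* (moving⇒in-support x s t j* c* (ℚₚ.<⇒≢ w*<0)) killed
    where
    open IsStochastic st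
    w : Fin n × Fin q → ℚ
    w (j , c) = t j * direction x j c
    pairs : List (Fin n × Fin q)
    pairs = cartesianProduct (allFin n) (allFin q)
    enumerates : ∀ jc → jc ∈ pairs
    enumerates (j , c) = ∈-cartesianProduct⁺ (∈-allFin j) (∈-allFin c)

  shrink-support : ∀ {x} → IsStochastic x → (vs : List Word) → length vs Nat.< count (split? x) →
    Σ Weights λ x′ → IsStochastic x′ × x′ ⊑ x × All (λ v → agreement x′ v ≡ agreement x v) vs ×
                     supportSize x′ Nat.< supportSize x
  shrink-support {x} st vs fewer =
    let t , (j₀ , tⱼ₀≢0) , t-free , t⊥ = nontrivial-solution (split? x) (map (constraint x) vs)
          (subst (Nat._< count (split? x)) (sym (Listₚ.length-map (constraint x) vs)) fewer)
        j₀-split = decidable-stable (split? x j₀) λ unsplit → tⱼ₀≢0 (t-free j₀ unsplit)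
        s , stochastic , smaller = step-to-smaller-support st t j₀-split tⱼ₀≢0
    in perturb x s t , stochastic , perturb-⊑ x s t , All.map (λ {v} → perturb-agreement x s t v) (Allₚ.map⁻ t⊥) , smaller

  supported-word : ∀ {x} → IsStochastic x → ∃ (Supports x)
  supported-word {x} st = (λ j → proj₁ (positive-entry (x j) (rowSum j))) , (λ j → proj₂ (positive-entry (x j) (rowSum j)))
    where open IsStochastic st

  module _ (p : ℕ → Word) where

    Rounding : ℕ → Weights → Set
    Rounding k x = Σ Word λ u → Supports x u ×
      (∀ i → i Nat.< k → fromℕ (matches u (p i)) < agreement x (p i) + fromℕ (suc i))

    rounding-transfer : ∀ {k x x′} → x′ ⊑ x → (∀ i → i Nat.< k → agreement x′ (p i) ≡ agreement x (p i)) →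
      Rounding k x′ → Rounding k x
    rounding-transfer x′⊑x kept (u , supp , bounds) = u , (λ j → x′⊑x j (u j) (supp j)) , λ i i<k →
      subst (λ a → fromℕ (matches u (p i)) < a + fromℕ (suc i)) (kept i i<k) (bounds i i<k)

    rounding-extend : ∀ {k x} → IsStochastic x → count (split? x) Nat.≤ suc k → Rounding k x → Rounding (suc k) x
    rounding-extend {k} {x} st few (u , supp , bounds) = u , supp , bound
      where
      bound : ∀ i → i Nat.< suc k → fromℕ (matches u (p i)) < agreement x (p i) + fromℕ (suc i)
      bound i i<1+k with ℕₚ.m<1+n⇒m<n∨m≡n i<1+k
      ... | inj₁ i<k  = bounds i i<k
      ... | inj₂ refl = rounding-bound st supp (p k) few

    round : ∀ k {x} → IsStochastic x → Rounding k x
    round zero          st = proj₁ (supported-word st) , proj₂ (supported-word st) , λ _ ()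
    round (suc k) {x} st = round-from x st (<-wellFounded (supportSize x))
      where
      round-from : ∀ x → IsStochastic x → Acc Nat._<_ (supportSize x) → Rounding (suc k) x
      round-from x st (acc smaller) with count (split? x) ℕₚ.≤? suc k
      ... | yes few = rounding-extend st few (round k st)
      ... | no many =
        let x′ , st′ , x′⊑x , kept , shrinks = shrink-support st (applyUpTo p (suc k))
              (subst (Nat._< count (split? x)) (sym (Listₚ.length-applyUpTo p (suc k))) (ℕₚ.≰⇒> many))
        in rounding-transfer x′⊑x (λ i → Allₚ.applyUpTo⁻ p (suc k) kept) (round-from x′ st′ (smaller shrinks))

  matches-cong : ∀ {u u′ v v′ : Word} → (∀ j → u j ≡ u′ j) → (∀ j → v j ≡ v′ j) → matches u v ≡ matches u′ v′
  matches-cong u≗u′ v≗v′ = ℕSum.sum-cong-≗ λ j → cong₂ (λ a b → indicator (a Finₚ.≟ b)) (u≗u′ j) (v≗v′ j)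

hamming-+-matches : ∀ {n q} (u v : Vertex n q) → hamming u v Nat.+ FractionalWords.matches (lookup u) (lookup v) ≡ n
hamming-+-matches []       []       = refl
hamming-+-matches (x ∷ xs) (y ∷ ys) with x Finₚ.≟ y
... | yes _ = trans (ℕₚ.+-suc (hamming xs ys) _) (cong suc (hamming-+-matches xs ys))
... | no  _ = cong suc (hamming-+-matches xs ys)

module LowerBoundArithmetic where

  open Nat using (_+_; _*_; _∸_; _≤_)

  short-sequence-bounds : ∀ {b n q′} → b * suc q′ ≤ q′ * n → b ≤ n × n ≤ suc q′ * (n ∸ b)
  short-sequence-bounds {b} {n} {q′} bq≤q′n = b≤n , n≤qD
    where
    b≤n : b ≤ n
    b≤n = ℕₚ.*-cancelʳ-≤ b n (suc q′) (begin
      b * suc q′    ≤⟨ bq≤q′n ⟩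
      q′ * n        ≤⟨ ℕₚ.m≤n+m (q′ * n) n ⟩
      suc q′ * n    ≡⟨ ℕₚ.*-comm (suc q′) n ⟩
      n * suc q′    ∎)
      where open ℕₚ.≤-Reasoning
    n≤qD : n ≤ suc q′ * (n ∸ b)
    n≤qD = subst (n ≤_) (sym (ℕₚ.*-distribˡ-∸ (suc q′) n b))
             (ℕₚ.m+n≤o⇒m≤o∸n n (ℕₚ.+-monoʳ-≤ n (subst (_≤ q′ * n) (ℕₚ.*-comm b (suc q′)) bq≤q′n)))

  split-at-radius : ∀ {r b n} → r ≤ b → b ≤ n → (b ∸ r) + ((n ∸ b) + r) ≡ n
  split-at-radius {r} {b} {n} r≤b b≤n = begin
    (b ∸ r) + ((n ∸ b) + r)   ≡⟨ cong ((b ∸ r) +_) (ℕₚ.+-comm (n ∸ b) r) ⟩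
    (b ∸ r) + (r + (n ∸ b))   ≡⟨ ℕₚ.+-assoc (b ∸ r) r (n ∸ b) ⟨
    (b ∸ r) + r + (n ∸ b)     ≡⟨ cong (_+ (n ∸ b)) (ℕₚ.m∸n+n≡m r≤b) ⟩
    b + (n ∸ b)               ≡⟨ ℕₚ.m+[n∸m]≡n b≤n ⟩
    n                         ∎
    where open ≡-Reasoning

module LowerBound {n q′ : ℕ} where

  open Rationals
  import Data.Rational.Properties as ℚₚ
  open FractionalWords {n} {suc q′}
  open import Data.Rational.Solver using (module +-*-Solver)
  open +-*-Solver using (solve; _:*_; _:=_)

  private
    q : ℕ
    q = suc q′
    instance
      q≢0 : NonZero (fromℕ q)
      q≢0 = >-nonZero (fromℕ-suc-pos q′)

  0≤1/q : 0ℚ ≤ 1/ fromℕ q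
  0≤1/q = ℚₚ.<⇒≤ (ℚₚ.positive⁻¹ _ {{ℚₚ.1/pos⇒pos (fromℕ q) {{positive (fromℕ-suc-pos q′)}}}})

  uniform : Weights
  uniform j c = 1/ fromℕ q

  uniform-stochastic : IsStochastic uniform
  uniform-stochastic = record
    { nonNeg = λ j c → 0≤1/q
    ; rowSum = λ j → trans (∑-const {q} (1/ fromℕ q)) (ℚₚ.*-inverseʳ (fromℕ q))
    }

  uniform-agreement : ∀ {D} → n Nat.≤ q Nat.* D → ∀ v → agreement uniform v ≤ fromℕ D
  uniform-agreement {D} n≤qD v = begin
    ∑ {n} (λ _ → 1/ fromℕ q)          ≡⟨ ∑-const {n} (1/ fromℕ q) ⟩
    fromℕ n * 1/ fromℕ q              ≤⟨ ℚₚ.*-monoʳ-≤-nonNeg (1/ fromℕ q) {{nonNegative 0≤1/q}} (fromℕ-mono-≤ n≤qD) ⟩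
    fromℕ (q Nat.* D) * 1/ fromℕ q    ≡⟨ cong (_* 1/ fromℕ q) (fromℕ-* q D) ⟩
    fromℕ q * fromℕ D * 1/ fromℕ q    ≡⟨ solve 3 (λ a d r → a :* d :* r := d :* (a :* r)) refl (fromℕ q) (fromℕ D) (1/ fromℕ q) ⟩
    fromℕ D * (fromℕ q * 1/ fromℕ q)  ≡⟨ cong (fromℕ D *_) (ℚₚ.*-inverseʳ (fromℕ q)) ⟩
    fromℕ D * 1ℚ                      ≡⟨ ℚₚ.*-identityʳ (fromℕ D) ⟩
    fromℕ D                           ∎
    where open ℚₚ.≤-Reasoning

  uniform-rounding : ∀ b {D} → n Nat.≤ q Nat.* D → (p : ℕ → Word) →
    ∃ λ u → ∀ i → i Nat.< b → matches u (p i) Nat.< D Nat.+ suc i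
  uniform-rounding b {D} n≤qD p with round p b uniform-stochastic
  ... | u , _ , bounds = u , λ i i<b → fromℕ-cancel-< (begin-strict
    fromℕ (matches u (p i))                     <⟨ bounds i i<b ⟩
    agreement uniform (p i) + fromℕ (suc i)     ≤⟨ ℚₚ.+-monoˡ-≤ (fromℕ (suc i)) (uniform-agreement n≤qD (p i)) ⟩
    fromℕ D + fromℕ (suc i)                     ≡⟨ fromℕ-+ D (suc i) ⟨
    fromℕ (D Nat.+ suc i)                       ∎)
    where open ℚₚ.≤-Reasoning

  module _ {b} (s : Vec (Vertex n q) b) where

    -- Indices beyond the sequence are never consulted, so any word serves there.
    point : ℕ → Word
    point i with i ℕₚ.<? b
    ... | yes i<b = lookup (lookup s (fromℕ< i<b))
    ... | no  _   = λ _ → zero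

    point-toℕ : ∀ i j → lookup (lookup s i) j ≡ point (toℕ i) j
    point-toℕ i j with toℕ i ℕₚ.<? b
    ... | yes i<b = cong (λ k → lookup (lookup s k) j) (sym (Finₚ.fromℕ<-toℕ i i<b))
    ... | no  i≮b = ⊥-elim (i≮b (Finₚ.toℕ<n i))

    escapes-every-ball : ∀ {u} → b Nat.≤ n → (∀ i → i Nat.< b → matches u (point i) Nat.< (n Nat.∸ b) Nat.+ suc i) →
      ∀ i → ¬ InBall (b Nat.∸ suc (toℕ i)) (lookup s i) (tabulate u)
    escapes-every-ball {u} b≤n matches-bound i U∈ball = ℕₚ.<-irrefl refl (begin-strict
      n                                                               ≡⟨ hamming-+-matches U (lookup s i) ⟨
      hamming U (lookup s i) Nat.+ matches (lookup U) (lookup (lookup s i))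
                                                                      ≡⟨ cong (hamming U (lookup s i) Nat.+_)
                                                                           (matches-cong (Vecₚ.lookup∘tabulate u) (point-toℕ i)) ⟩
      hamming U (lookup s i) Nat.+ matches u (point (toℕ i))          <⟨ ℕₚ.+-mono-≤-< U∈ball (matches-bound (toℕ i) (Finₚ.toℕ<n i)) ⟩
      (b Nat.∸ suc (toℕ i)) Nat.+ ((n Nat.∸ b) Nat.+ suc (toℕ i))     ≡⟨ LowerBoundArithmetic.split-at-radius (Finₚ.toℕ<n i) b≤n ⟩
      n                                                               ∎)
      where
      open ℕₚ.≤-Reasoning
      U : Vertex n q
      U = tabulate u

    no-short-burning : b Nat.* q Nat.≤ q′ Nat.* n → ¬ IsBurningSeq b s
    no-short-burning bq≤q′n burns =
      let b≤n , n≤qD       = LowerBoundArithmetic.short-sequence-bounds {b} {n} {q′} bq≤q′n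
          u , matches-bound = uniform-rounding b n≤qD point
          i , U∈ball        = burns (tabulate u)
      in escapes-every-ball b≤n matches-bound i U∈ball

hamming≤n : ∀ {n q} (u v : Vertex n q) → hamming u v Nat.≤ n
hamming≤n []       []       = Nat.z≤n
hamming≤n (x ∷ xs) (y ∷ ys) with x Finₚ.≟ y
... | yes _ = ℕₚ.m≤n⇒m≤1+n (hamming≤n xs ys)
... | no  _ = Nat.s≤s (hamming≤n xs ys)

-- floor is the defining property of U = ⌊N / 2q⌋ for N = 2(q−1)n + q(q+1), the numerator of upperBound.
module UpperBoundArithmetic (n q′ U : ℕ)
  (floor : 2 Nat.* (q′ Nat.* n) Nat.+ suc q′ Nat.* (suc q′ Nat.+ 1) Nat.< suc U Nat.* (2 Nat.* suc q′)) where

  open Nat using (_+_; _*_; _≤_; _<_)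
  open import Data.Nat.Tactic.RingSolver using (solve-∀)
  open ℕₚ.≤-Reasoning

  private
    q N : ℕ
    q = suc q′
    N = 2 * (q′ * n) + q * (q + 1)

  q≤2U : q ≤ 2 * U
  q≤2U = ℕₚ.≤-pred (ℕₚ.≤-pred (ℕₚ.*-cancelˡ-< q (suc q) (suc (suc (2 * U))) (begin-strict
    q * suc q                 ≡⟨ cong (q *_) (ℕₚ.+-comm 1 q) ⟩
    q * (q + 1)               ≤⟨ ℕₚ.m≤n+m (q * (q + 1)) (2 * (q′ * n)) ⟩
    N                         <⟨ floor ⟩
    suc U * (2 * q)           ≡⟨ rearrange U q′ ⟩
    q * suc (suc (2 * U))     ∎)))
    where
    rearrange : ∀ U q′ → suc U * (2 * suc q′) ≡ suc q′ * suc (suc (2 * U))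
    rearrange = solve-∀

  U≤n⇒q≤U : U ≤ n → q ≤ U
  U≤n⇒q≤U U≤n = ℕₚ.≮⇒≥ λ U<q → ℕₚ.<-irrefl refl (begin-strict
    q * (2 * q)                     ≡⟨ split-square q′ ⟩
    q′ * q + q * (q + 1)            ≤⟨ ℕₚ.+-monoˡ-≤ (q * (q + 1)) (ℕₚ.*-monoʳ-≤ q′ (ℕₚ.≤-trans q≤2U (ℕₚ.*-monoʳ-≤ 2 U≤n))) ⟩
    q′ * (2 * n) + q * (q + 1)      ≡⟨ cong (_+ q * (q + 1)) (double-inside q′ n) ⟩
    N                               <⟨ floor ⟩
    suc U * (2 * q)                 ≤⟨ ℕₚ.*-monoˡ-≤ (2 * q) U<q ⟩
    q * (2 * q)                     ∎)
    where
    split-square : ∀ q′ → suc q′ * (2 * suc q′) ≡ q′ * suc q′ + suc q′ * (suc q′ + 1)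
    split-square = solve-∀
    double-inside : ∀ a m → a * (2 * m) ≡ 2 * (a * m)
    double-inside = solve-∀

  average-too-small : ¬ (2 * (q * U) ≤ 2 * (q′ * n) + q * q′)
  average-too-small small = ℕₚ.<-irrefl refl (begin-strict
    N                               <⟨ floor ⟩
    suc U * (2 * q)                 ≡⟨ expand U q′ ⟩
    2 * (q * U) + 2 * q             ≤⟨ ℕₚ.+-monoˡ-≤ (2 * q) small ⟩
    2 * (q′ * n) + q * q′ + 2 * q   ≡⟨ collect (q′ * n) q′ ⟩
    N                               ∎)
    where
    expand : ∀ U q′ → suc U * (2 * suc q′) ≡ 2 * (suc q′ * U) + 2 * suc q′
    expand = solve-∀
    collect : ∀ m q′ → 2 * m + suc q′ * q′ + 2 * suc q′ ≡ 2 * m + suc q′ * (suc q′ + 1)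
    collect = solve-∀

module UpperBound {n q′ : ℕ} where

  open Nat using (_+_; _*_; _∸_; _≤_; _<_)
  open import Data.Nat.DivMod using (_/_; _%_; _mod_; m≡m%n+[m/n]*n; m%n<n; m<n⇒m%n≡m)
  open import Data.Sum using ([_,_]′)
  open ℕSum using (sum-cong-≗; ∑-distrib-+; ∑-comm)
  open FractionalWords {n} {suc q′} using (matches; matches-cong)

  private
    q : ℕ
    q = suc q′

  U : ℕ
  U = upperBound n q

  floor : 2 * (q′ * n) + q * (q + 1) < suc U * (2 * q)
  floor = begin-strict
    N                                   ≡⟨ m≡m%n+[m/n]*n N (2 * q) ⟩
    N % (2 * q) + N / (2 * q) * (2 * q) <⟨ ℕₚ.+-monoˡ-< (N / (2 * q) * (2 * q)) (m%n<n N (2 * q)) ⟩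
    suc (N / (2 * q)) * (2 * q)         ∎
    where
    open ℕₚ.≤-Reasoning
    N : ℕ
    N = 2 * (q′ * n) + q * (q + 1)

  open UpperBoundArithmetic n q′ U floor

  color : Fin U → Fin q
  color i = toℕ i mod q

  color-fromℕ< : ∀ (c : Fin q) (c<U : toℕ c < U) → color (fromℕ< c<U) ≡ c
  color-fromℕ< c c<U = Finₚ.toℕ-injective (begin
    toℕ (toℕ (fromℕ< c<U) mod q)   ≡⟨ Finₚ.toℕ-fromℕ< (m%n<n (toℕ (fromℕ< c<U)) q) ⟩
    toℕ (fromℕ< c<U) % q           ≡⟨ cong (_% q) (Finₚ.toℕ-fromℕ< c<U) ⟩
    toℕ c % q                      ≡⟨ m<n⇒m%n≡m (Finₚ.toℕ<n c) ⟩
    toℕ c                          ∎)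
    where open ≡-Reasoning

  constant-words : Vec (Vertex n q) U
  constant-words = tabulate λ i → replicate n (color i)

  module _ (u : Vertex n q) where

    hamming-to : Fin q → ℕ
    hamming-to c = hamming u (replicate n c)

    matches-with : Fin q → ℕ
    matches-with c = matches (lookup u) (λ _ → c)

    ∑-matches-constant : ∑ℕ matches-with ≡ n
    ∑-matches-constant = begin
      ∑ℕ (λ c → ∑ℕ λ j → indicator (lookup u j Finₚ.≟ c))   ≡⟨ ∑-comm (λ c j → indicator (lookup u j Finₚ.≟ c)) ⟩
      ∑ℕ (λ j → ∑ℕ λ c → indicator (lookup u j Finₚ.≟ c))   ≡⟨ sum-cong-≗ (λ j → count-≟ (lookup u j)) ⟩
      ∑ℕ {n} (λ _ → 1)                                     ≡⟨ ∑ℕ-const {n} 1 ⟩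
      n * 1                                                ≡⟨ ℕₚ.*-identityʳ n ⟩
      n                                                    ∎
      where open ≡-Reasoning

    ∑-hamming-constant : ∑ℕ hamming-to ≡ q′ * n
    ∑-hamming-constant = ℕₚ.+-cancelʳ-≡ n (∑ℕ hamming-to) (q′ * n) (begin
      ∑ℕ hamming-to + n                                   ≡⟨ cong (∑ℕ hamming-to +_) ∑-matches-constant ⟨
      ∑ℕ hamming-to + ∑ℕ matches-with                     ≡⟨ ∑-distrib-+ hamming-to matches-with ⟨
      ∑ℕ (λ c → hamming-to c + matches-with c)            ≡⟨ sum-cong-≗ hamming-+-matches-constant ⟩
      ∑ℕ {q} (λ _ → n)                                    ≡⟨ ∑ℕ-const {q} n ⟩
      q * n                                               ≡⟨ ℕₚ.+-comm n (q′ * n) ⟩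
      q′ * n + n                                          ∎)
      where
      open ≡-Reasoning
      hamming-+-matches-constant : ∀ c → hamming-to c + matches-with c ≡ n
      hamming-+-matches-constant c =
        trans (cong (hamming-to c +_) (matches-cong {u = lookup u} (λ _ → refl) (λ j → sym (Vecₚ.lookup-replicate j c))))
              (hamming-+-matches u (replicate n c))

    covered-by-first : n < U → ∃ λ i → InBall (U ∸ suc (toℕ i)) (lookup constant-words i) u
    covered-by-first n<U = fromℕ< 0<U , subst (λ k → hamming u (lookup constant-words (fromℕ< 0<U)) ≤ U ∸ suc k)
                                              (sym (Finₚ.toℕ-fromℕ< 0<U))
                                              (ℕₚ.≤-trans (hamming≤n u _) (ℕₚ.m+n≤o⇒m≤o∸n n (subst (_≤ U) (ℕₚ.+-comm 1 n) n<U)))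
      where
      0<U : 0 < U
      0<U = ℕₚ.≤-<-trans Nat.z≤n n<U

    covered-by-color : ∀ c (c<U : toℕ c < U) → hamming-to c + toℕ c < U →
      InBall (U ∸ suc (toℕ (fromℕ< c<U))) (lookup constant-words (fromℕ< c<U)) u
    covered-by-color c c<U close = subst₂ (λ v k → hamming u v ≤ U ∸ suc k) (sym at-c) (sym (Finₚ.toℕ-fromℕ< c<U))
      (ℕₚ.m+n≤o⇒m≤o∸n (hamming-to c) (subst (_≤ U) (sym (ℕₚ.+-suc (hamming-to c) (toℕ c))) close))
      where
      at-c : lookup constant-words (fromℕ< c<U) ≡ replicate n c
      at-c = trans (Vecₚ.lookup∘tabulate (λ i → replicate n (color i)) (fromℕ< c<U)) (cong (replicate n) (color-fromℕ< c c<U))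

    some-color-close : ∃ λ c → hamming-to c + toℕ c < U
    some-color-close =
      let c , ¬far = Finₚ.¬∀⟶∃¬ q (λ c → U ≤ hamming-to c + toℕ c) (λ c → U ℕₚ.≤? hamming-to c + toℕ c) all-far-impossible
      in c , ℕₚ.≰⇒> ¬far
      where
      all-far-impossible : ¬ (∀ c → U ≤ hamming-to c + toℕ c)
      all-far-impossible all-far = average-too-small (begin
        2 * (q * U)                                   ≡⟨ cong (2 *_) (∑ℕ-const {q} U) ⟨
        2 * ∑ℕ {q} (λ _ → U)                          ≤⟨ ℕₚ.*-monoʳ-≤ 2 (∑ℕ-mono-≤ all-far) ⟩
        2 * ∑ℕ (λ c → hamming-to c + toℕ c)           ≡⟨ cong (2 *_) (∑-distrib-+ hamming-to toℕ) ⟩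
        2 * (∑ℕ hamming-to + ∑ℕ {q} toℕ)              ≡⟨ ℕₚ.*-distribˡ-+ 2 (∑ℕ hamming-to) (∑ℕ {q} toℕ) ⟩
        2 * ∑ℕ hamming-to + 2 * ∑ℕ {q} toℕ            ≡⟨ cong₂ (λ a b → 2 * a + b) ∑-hamming-constant (double-∑-toℕ q′) ⟩
        2 * (q′ * n) + q * q′                         ∎)
        where open ℕₚ.≤-Reasoning

    covered : ∃ λ i → InBall (U ∸ suc (toℕ i)) (lookup constant-words i) u
    covered = [ covered-by-first , covered-by-colors ]′ (ℕₚ.<-≤-connex n U)
      where
      covered-by-colors : U ≤ n → ∃ λ i → InBall (U ∸ suc (toℕ i)) (lookup constant-words i) u
      covered-by-colors U≤n =
        let c , close = some-color-close
            c<U = ℕₚ.<-≤-trans (Finₚ.toℕ<n c) (U≤n⇒q≤U U≤n)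
        in fromℕ< c<U , covered-by-color c c<U close

  constant-words-burn : IsBurningSeq U constant-words
  constant-words-burn = covered

Searchable : Set → Set₁
Searchable A = ∀ {P : Pred A 0ℓ} → Decidable P → Dec (∃ P)

Vec-searchable : ∀ {A m} → Searchable A → Searchable (Vec A m)
Vec-searchable {m = zero}  search P? = map′ ([] ,_) (λ { ([] , P[]) → P[] }) (P? [])
Vec-searchable {m = suc m} search P? =
  map′ (λ (x , xs , P[x∷xs]) → x ∷ xs , P[x∷xs]) (λ { (x ∷ xs , P[x∷xs]) → x , xs , P[x∷xs] })
       (search λ x → Vec-searchable search λ xs → P? (x ∷ xs))

∀? : ∀ {A} → Searchable A → ∀ {P : Pred A 0ℓ} → Decidable P → Dec (∀ a → P a)
∀? search P? = map′ (λ ∄¬P a → decidable-stable (P? a) λ ¬Pa → ∄¬P (a , ¬Pa)) (λ ∀P (a , ¬Pa) → ¬Pa (∀P a))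
                    (¬? (search (¬? ∘ P?)))

isBurningSeq? : ∀ {n q} b (s : Vec (Vertex n q) b) → Dec (IsBurningSeq b s)
isBurningSeq? b s = ∀? (Vec-searchable Finₚ.any?) λ u → Finₚ.any? λ i → hamming u (lookup s i) ℕₚ.≤? b Nat.∸ suc (toℕ i)

hasBurningSeq? : ∀ n q b → Dec (HasBurningSeq n q b)
hasBurningSeq? n q b = Vec-searchable (Vec-searchable Finₚ.any?) (isBurningSeq? b)

Least : Pred ℕ 0ℓ → Set
Least P = ∃ λ b → P b × ∀ b′ → P b′ → b Nat.≤ b′

least-witness : ∀ {P : Pred ℕ 0ℓ} → Decidable P → ∀ {m} → P m → Least P
least-witness {P} P? {m} = <-rec (λ m → P m → Least P) below m
  where
  below : ∀ m → (∀ {k} → k Nat.< m → P k → Least P) → P m → Least P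
  below m smaller Pm with ℕₚ.anyUpTo? P? m
  ... | yes (k , k<m , Pk) = smaller k<m Pk
  ... | no  none           = m , Pm , λ b′ Pb′ → ℕₚ.≮⇒≥ λ b′<m → none (b′ , b′<m , Pb′)

lowerBound<burning : ∀ {n q′ b} → HasBurningSeq n (suc q′) b → lowerBound n (suc q′) Nat.< b
lowerBound<burning {n} {q′} (s , burns) = ℕₚ.≰⇒> λ b≤lb →
  LowerBound.no-short-burning s (ℕₚ.≤-trans (ℕₚ.*-monoˡ-≤ (suc q′) b≤lb) (DivMod.m/n*n≤m (q′ Nat.* n) (suc q′))) burns

theorem1p2 : (n q : ℕ) → 3 Nat.≤ q → 1 Nat.≤ n →
    Σ ℕ λ b → IsBurningNumber n q b × (suc (lowerBound n q) Nat.≤ b × b Nat.≤ upperBound n q)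
theorem1p2 n (suc q′) _ _ =
  let b , burns , minimal = least-witness (hasBurningSeq? n (suc q′)) upper-witness
  in b , (burns , minimal) , lowerBound<burning burns , minimal (upperBound n (suc q′)) upper-witness
  where
  upper-witness : HasBurningSeq n (suc q′) (upperBound n (suc q′))
  upper-witness = UpperBound.constant-words , UpperBound.constant-words-burn
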